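{- There exists an RPN $\mathcal N$ such that no quasi-order on the states of $\mathcal N$ is simultaneously a well quasi-order and transition-preserving compatible.
   Context: A Recursive Petri Net (RPN) is a tuple $\mathcal N=\langle P,T,W^+,W^-,\Omega\rangle$ where $P$ is a finite set of places, $T=T_{el}\uplus T_{ab}\uplus T_{\tau}$ is a finite set of transitions disjoint from $P$ (elementary, abstract and cut transitions), $W^-\in\mathbb N^{P\times T}$, $W^+\in\mathbb N^{P\times(T_{el}\uplus T_{ab})}$, and $\Omega:T_{ab}\to\mathbb N^P$. Write $W^{\pm}(t)\in\mathbb N^P$ for the column of $t$; markings are compared componentwise. A (concrete) state is either the empty tree $\emptyset$ or a finite rooted tree whose vertices (threads) are taken from a fixed countably infinite set $\mathcal V$, each vertex $v$ labelled by a marking $M_s(v)\in\mathbb N^P$ and each edge labelled by a vector in $\{W^+(t):t\in T_{ab}\}$. Firing rule: a thread $v$ of a state $s\neq\emptyset$ can fire $t$ if $W^-(t)\le M_s(v)$, giving $s\xrightarrow{(v,t)}s'$ where: if $t\in T_{el}$, the marking of $v$ becomes $M_s(v)-W^-(t)+W^+(t)$; if $t\in T_{ab}$, the marking of $v$ becomes $M_s(v)-W^-(t)$ and a new child $w$ of $v$ (a vertex never used before) is created with marking $\Omega(t)$ and edge $v\to w$ labelled $W^+(t)$; if $t\in T_\tau$, the subtree rooted at $v$ is deleted, and if $v$ is the root the result is $\emptyset$, otherwise the marking of the parent $u$ of $v$ is increased by the label of the edge $u\to v$. A quasi-order $\le$ on states is transition-preserving compatible if for all states $s\le s'$ and every firing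 $s\xrightarrow{(v,t)}s_1$ there exist a thread $v'$ of $s'$ and a firing $s'\xrightarrow{(v',t)}s'_1$ (same transition $t$) with $s_1\le s'_1$. -}

module Defs where

open import Data.Nat using (ℕ; _<_)
import Data.Nat as Nat
open import Data.Fin using (Fin)
open import Data.Vec using (Vec; zipWith; replicate)
open import Data.Vec.Relation.Binary.Pointwise.Inductive using (Pointwise)
open import Data.List using (List; []; _∷_; _++_; [_])
open import Data.List.Membership.Propositional using (_∈_)
open import Data.List.Relation.Unary.Unique.Propositional using (Unique)
open import Data.List.Relation.Binary.Permutation.Propositional using (_↭_)
open import Data.Maybe using (Maybe; just; nothing)
open import Data.Product using (Σ; ∃; _×_; _,_)
open import Data.Sum using (_⊎_; inj₁; inj₂)
open import Relation.Nullary using (¬_)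
open import Data.Empty using (⊥)
open import Relation.Binary.PropositionalEquality using (_≡_)

Marking : ℕ → Set
Marking p = Vec ℕ p

record RPN : Set where
  field
    p   : ℕ
    nel : ℕ
    nab : ℕ
    nτ  : ℕ
    W⁻   : Fin nel ⊎ Fin nab ⊎ Fin nτ → Marking p
    W⁺el : Fin nel → Marking p
    W⁺ab : Fin nab → Marking p
    Ω    : Fin nab → Marking p

module _ (N : RPN) where
  open RPN N

  Trans : Set
  Trans = Fin nel ⊎ Fin nab ⊎ Fin nτ

  _≤M_ : Marking p → Marking p → Set
  _≤M_ = Pointwise Nat._≤_

  _+M_ _∸M_ : Marking p → Marking p → Marking p
  _+M_ = zipWith Nat._+_
  _∸M_ = zipWith Nat._∸_

  0M : Marking p
  0M = replicate p 0

  -- Labelled rooted trees: a vertex name (threads come from V = ℕ),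
  -- its marking, and its children each with the label of the edge to it.
  data Tree : Set where
    node : ℕ → Marking p → List (Marking p × Tree) → Tree

  Forest : Set
  Forest = List (Marking p × Tree)

  verts  : Tree → List ℕ
  vertsF : Forest → List ℕ
  verts (node v _ cs) = v ∷ vertsF cs
  vertsF [] = []
  vertsF ((_ , c) ∷ cs) = verts c ++ vertsF cs

  data LabelsOK  : Tree → Set
  data LabelsOKF : Forest → Set
  data LabelsOK where
    node : ∀ {v m cs} → LabelsOKF cs → LabelsOK (node v m cs)
  data LabelsOKF where
    []  : LabelsOKF []
    _∷_ : ∀ {l c cs} → (∃ λ (t : Fin nab) → l ≡ W⁺ab t) → LabelsOK c →
          LabelsOKF cs → LabelsOKF ((l , c) ∷ cs)

  WF : Tree → Set
  WF T = Unique (verts T) × LabelsOK T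

  data State : Set where
    ∅  : State
    tr : (T : Tree) → WF T → State

  -- Trees are unordered: equality of concrete states up to reordering
  -- of the children of each vertex.
  data _≅T_ : Tree → Tree → Set
  data _≅F_ : Forest → Forest → Set
  data _≅T_ where
    node : ∀ {v m cs ds} → cs ≅F ds → node v m cs ≅T node v m ds
  data _≅F_ where
    []    : [] ≅F []
    _∷_   : ∀ {l c d cs ds} → c ≅T d → cs ≅F ds → ((l , c) ∷ cs) ≅F ((l , d) ∷ ds)
    perm  : ∀ {cs ds} → cs ↭ ds → cs ≅F ds
    trans : ∀ {cs ds es} → cs ≅F ds → ds ≅F es → cs ≅F es

  data _≅S_ : State → State → Set where
    ∅  : ∅ ≅S ∅
    tr : ∀ {T U wT wU} → T ≅T U → tr T wT ≅S tr U wU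

  -- Firing of transition t by thread v inside a tree; w is the name of the
  -- new child (only used for abstract transitions).  The result is
  -- `nothing` when the whole tree is cut.
  data FireT : Tree → ℕ → Trans → ℕ → Maybe Tree → Set
  -- firing inside a forest of children; δ is what is added to the parent
  data FireF : Forest → ℕ → Trans → ℕ → Forest → Marking p → Set
  data FireT where
    el   : ∀ {v m cs w} (t : Fin nel) → W⁻ (inj₁ t) ≤M m →
           FireT (node v m cs) v (inj₁ t) w
                 (just (node v ((m ∸M W⁻ (inj₁ t)) +M W⁺el t) cs))
    ab   : ∀ {v m cs w} (t : Fin nab) → W⁻ (inj₂ (inj₁ t)) ≤M m →
           FireT (node v m cs) v (inj₂ (inj₁ t)) w
                 (just (node v (m ∸M W⁻ (inj₂ (inj₁ t)))
                              (cs ++ [ (W⁺ab t , node w (Ω t) []) ])))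
    cut  : ∀ {v m cs w} (t : Fin nτ) → W⁻ (inj₂ (inj₂ t)) ≤M m →
           FireT (node v m cs) v (inj₂ (inj₂ t)) w nothing
    deep : ∀ {u m cs v t w cs' δ} → FireF cs v t w cs' δ →
           FireT (node u m cs) v t w (just (node u (m +M δ) cs'))
  data FireF where
    here  : ∀ {l c cs v t w c'} → FireT c v t w (just c') →
            FireF ((l , c) ∷ cs) v t w ((l , c') ∷ cs) 0M
    hereτ : ∀ {l c cs v t w} → FireT c v t w nothing →
            FireF ((l , c) ∷ cs) v t w cs l
    there : ∀ {l c cs v t w cs' δ} → FireF cs v t w cs' δ →
            FireF ((l , c) ∷ cs) v t w ((l , c) ∷ cs') δ

  Step : State → ℕ → Trans → State → Set
  Step ∅ v t s' = ⊥
  Step (tr T _) v t ∅ = ∃ λ w → ¬ (w ∈ verts T) × FireT T v t w nothing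
  Step (tr T _) v t (tr T' _) = ∃ λ w → ¬ (w ∈ verts T) × FireT T v t w (just T')

  -- a quasi-order on states (of the unordered trees: it contains ≅S)
  IsQuasiOrderOnStates : (State → State → Set) → Set
  IsQuasiOrderOnStates _≤_ =
    (∀ {s s'} → s ≅S s' → s ≤ s') ×
    (∀ {s} → s ≤ s) ×
    (∀ {s s' s''} → s ≤ s' → s' ≤ s'' → s ≤ s'')

  IsWQO : (State → State → Set) → Set
  IsWQO _≤_ = IsQuasiOrderOnStates _≤_ ×
    ((f : ℕ → State) → ∃ λ i → ∃ λ j → i < j × f i ≤ f j)

  TransitionPreservingCompatible : (State → State → Set) → Set
  TransitionPreservingCompatible _≤_ =
    ∀ {s s'} → s ≤ s' → ∀ v t s₁ → Step s v t s₁ →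
    ∃ λ v' → ∃ λ s₁' → Step s' v' t s₁' × s₁ ≤ s₁'

-- A transition-preserving compatible order makes every larger state simulate
-- every firing sequence of a smaller one.  In the net below, the state sₙ is a
-- root holding a token in place q whose single child is a chain of n empty
-- threads ending in a thread holding a token in place p.  Cutting the leaf
-- moves its p-token to its parent, so sₙ fires τⁿ⁺¹ and then e at the root.
-- In sₘ with m > n only the root has a q-token and only the leaf has a
-- p-token, so τ can only cut the leaf, and after n + 1 cuts the root still
-- has no p-token: τⁿ⁺¹ e is disabled.  Hence sₙ ≤ sₘ never holds for n < m,
-- and (sₙ) is a bad sequence.
module Submission where

open import Defs
open import Data.Product using (Σ; _×_; _,_; proj₁; proj₂)
open import Relation.Nullary using (¬_)
open import Data.Nat using (ℕ; zero; suc; _+_; _≤_; _<_; z≤n; s≤s)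
open import Data.Nat.Properties using (≤-refl; ≤-trans; n≤1+n; <⇒≢; m≤n⇒∃[o]m+o≡n)
open import Data.Fin using (Fin; zero)
open import Data.Vec using (Vec; []; _∷_)
open import Data.Vec.Relation.Binary.Pointwise.Inductive using ([]; _∷_)
open import Data.List using (List; []; _∷_; _++_; [_]; replicate)
open import Data.List.Membership.Propositional using (_∈_)
open import Data.List.Relation.Unary.All as All using (All; []; _∷_)
open import Data.List.Relation.Unary.AllPairs using ([]; _∷_)
open import Data.List.Relation.Unary.Unique.Propositional using (Unique)
open import Data.List.Properties using (++-identityʳ)
open import Data.Sum using (_⊎_; inj₁; inj₂)
open import Data.Empty using (⊥-elim)
open import Data.Maybe using (just; nothing)
open import Relation.Binary.PropositionalEquality using (refl)

module _ {N : RPN} where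

  data Enabled : State N → List (Trans N) → Set where
    []  : ∀ {s} → Enabled s []
    _∷_ : ∀ {s v t s₁ ts} → Step N s v t s₁ → Enabled s₁ ts → Enabled s (t ∷ ts)

  module _ {_≼_ : State N → State N → Set}
           (compatible : TransitionPreservingCompatible N _≼_) where

    enabled-mono : ∀ {s s' ts} → s ≼ s' → Enabled s ts → Enabled s' ts
    enabled-mono s≼s' [] = []
    enabled-mono s≼s' (_∷_ {v = v} {t} {s₁} step rest)
      with compatible s≼s' v t s₁ step
    ... | _ , _ , step' , s₁≼s₁' = step' ∷ enabled-mono s₁≼s₁' rest

  ¬wqo×compatible-of-separating :
    (f : ℕ → State N) (w : ℕ → List (Trans N)) →
    (∀ n → Enabled (f n) (w n)) → (∀ {i j} → i < j → ¬ Enabled (f j) (w i)) →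
    (_≼_ : State N → State N → Set) →
    ¬ (IsWQO N _≼_ × TransitionPreservingCompatible N _≼_)
  ¬wqo×compatible-of-separating f w enabled disabled _≼_ (wqo , compatible)
    with proj₂ wqo f
  ... | i , j , i<j , fi≼fj = disabled i<j (enabled-mono compatible fi≼fj (enabled i))

edge : Vec ℕ 2
edge = 1 ∷ 0 ∷ []

-- Places p and q; e consumes one token from each, τ needs a token in p.
-- The abstract transition is never fired: it only makes edge a legal edge label.
W⁻ : Fin 1 ⊎ Fin 1 ⊎ Fin 1 → Vec ℕ 2
W⁻ (inj₁ _)        = 1 ∷ 1 ∷ []
W⁻ (inj₂ (inj₁ _)) = 0 ∷ 0 ∷ []
W⁻ (inj₂ (inj₂ _)) = 1 ∷ 0 ∷ []

net : RPN
net = record { p = 2 ; nel = 1 ; nab = 1 ; nτ = 1 ; W⁻ = W⁻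
             ; W⁺el = λ _ → 0 ∷ 0 ∷ [] ; W⁺ab = λ _ → edge ; Ω = λ _ → 0 ∷ 0 ∷ [] }

e τ : Trans net
e = inj₁ zero
τ = inj₂ (inj₂ zero)

data Chain : ℕ → Tree net → Set where
  leaf  : ∀ {v x} → Chain 0 (node v (x ∷ 0 ∷ []) [])
  unary : ∀ {v d c} → Chain d c → Chain (suc d) (node v (0 ∷ 0 ∷ []) ((edge , c) ∷ []))

data Stem : ℕ → Tree net → Set where
  stem : ∀ {v y d c} → Chain d c → Stem d (node v (0 ∷ y ∷ []) ((edge , c) ∷ []))

chain-¬fire-e : ∀ {d T v w r} → Chain d T → ¬ FireT net T v e w r
chain-¬fire-e leaf      (el _ (_ ∷ () ∷ []))
chain-¬fire-e leaf      (deep ())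
chain-¬fire-e (unary c) (el _ (() ∷ _))
chain-¬fire-e (unary c) (deep (here fire))  = chain-¬fire-e c fire
chain-¬fire-e (unary c) (deep (hereτ fire)) = chain-¬fire-e c fire
chain-¬fire-e (unary c) (deep (there ()))

chain-¬cut : ∀ {d T v w} → Chain (suc d) T → ¬ FireT net T v τ w nothing
chain-¬cut (unary c) (cut _ (() ∷ _))

chain-cut : ∀ {d T v w T'} → Chain (suc d) T → FireT net T v τ w (just T') → Chain d T'
chain-cut (unary leaf)      (deep (here (deep ())))
chain-cut (unary leaf)      (deep (hereτ (cut _ _)))  = leaf
chain-cut (unary (unary c)) (deep (here fire))        = unary (chain-cut (unary c) fire)
chain-cut (unary (unary c)) (deep (hereτ fire))       = ⊥-elim (chain-¬cut (unary c) fire)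
chain-cut (unary _)         (deep (there ()))

stem-¬fire-e : ∀ {d T v w r} → Stem d T → ¬ FireT net T v e w r
stem-¬fire-e (stem c) (el _ (() ∷ _))
stem-¬fire-e (stem c) (deep (here fire))  = chain-¬fire-e c fire
stem-¬fire-e (stem c) (deep (hereτ fire)) = chain-¬fire-e c fire
stem-¬fire-e (stem c) (deep (there ()))

stem-¬cut : ∀ {d T v w} → Stem d T → ¬ FireT net T v τ w nothing
stem-¬cut (stem c) (cut _ (() ∷ _))

stem-cut : ∀ {d T v w T'} → Stem (suc d) T → FireT net T v τ w (just T') → Stem d T'
stem-cut (stem c) (deep (here fire))  = stem (chain-cut c fire)
stem-cut (stem c) (deep (hereτ fire)) = ⊥-elim (chain-¬cut c fire)
stem-cut (stem c) (deep (there ()))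

probe : ℕ → List (Trans net)
probe n = replicate (suc n) τ ++ [ e ]

stem-disables : ∀ n {d T wT} → Stem (n + d) T → ¬ Enabled (tr T wT) (replicate n τ ++ [ e ])
stem-disables zero    s (_∷_ {s₁ = ∅}      (_ , _ , fire) _)    = stem-¬fire-e s fire
stem-disables zero    s (_∷_ {s₁ = tr _ _} (_ , _ , fire) _)    = stem-¬fire-e s fire
stem-disables (suc n) s (_∷_ {s₁ = ∅}      (_ , _ , fire) _)    = stem-¬cut s fire
stem-disables (suc n) s (_∷_ {s₁ = tr _ _} (_ , _ , fire) rest) =
  stem-disables n (stem-cut s fire) rest

chain : ℕ → ℕ → Tree net
chain b zero    = node b (1 ∷ 0 ∷ []) []
chain b (suc k) = node b (0 ∷ 0 ∷ []) ((edge , chain (suc b) k) ∷ [])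

chain-leaf : ℕ → ℕ → ℕ
chain-leaf b zero    = b
chain-leaf b (suc k) = chain-leaf (suc b) k

stem-tree : ℕ → Tree net
stem-tree n = node 1 (0 ∷ 1 ∷ []) ((edge , chain 2 n) ∷ [])

chain-is-Chain : ∀ b k → Chain k (chain b k)
chain-is-Chain b zero    = leaf
chain-is-Chain b (suc k) = unary (chain-is-Chain (suc b) k)

chain-labels : ∀ b k → LabelsOK net (chain b k)
chain-labels b zero    = node []
chain-labels b (suc k) = node (_∷_ (zero , refl) (chain-labels (suc b) k) [])

NamesFrom : ℕ → Tree net → Set
NamesFrom b T = All (b ≤_) (verts net T) × Unique (verts net T)

unary-names : ∀ {b m l c} → NamesFrom (suc b) c → NamesFrom b (node b m ((l , c) ∷ []))
unary-names {b} {c = c} (above , unique) rewrite ++-identityʳ (verts net c) =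
  (≤-refl ∷ All.map (≤-trans (n≤1+n b)) above) , (All.map <⇒≢ above ∷ unique)

chain-names : ∀ b k → NamesFrom b (chain b k)
chain-names b zero    = (≤-refl ∷ []) , ([] ∷ [])
chain-names b (suc k) = unary-names {m = 0 ∷ 0 ∷ []} {edge} (chain-names (suc b) k)

stem-names : ∀ n → NamesFrom 1 (stem-tree n)
stem-names n = unary-names {m = 0 ∷ 1 ∷ []} {edge} (chain-names 2 n)

stem-state : ℕ → State net
stem-state n =
  tr (stem-tree n) (proj₂ (stem-names n) , node (_∷_ (zero , refl) (chain-labels 2 n) []))

0∉ : ∀ {xs} → All (1 ≤_) xs → ¬ 0 ∈ xs
0∉ above 0∈ with All.lookup above 0∈
... | ()

cut-chain-leaf : ∀ b k → FireT net (chain b (suc k)) (chain-leaf (suc b) k) τ 0 (just (chain b k))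
cut-chain-leaf b zero    = deep (hereτ (cut zero (s≤s z≤n ∷ z≤n ∷ [])))
cut-chain-leaf b (suc k) = deep (here (cut-chain-leaf (suc b) k))

stem-state-enables-probe : ∀ n → Enabled (stem-state n) (probe n)
stem-state-enables-probe (suc n) =
  (0 , 0∉ (proj₁ (stem-names (suc n))) , deep (here (cut-chain-leaf 2 n)))
  ∷ stem-state-enables-probe n
stem-state-enables-probe zero =
  _∷_ {s₁ = root (1 ∷ 1 ∷ [])} cut-leaf (_∷_ {s₁ = root (0 ∷ 0 ∷ [])} fire-e [])
  where
    root : Vec ℕ 2 → State net
    root m = tr (node 1 m []) (([] ∷ []) , node [])

    cut-leaf : Step net (stem-state 0) 2 τ (root (1 ∷ 1 ∷ []))
    cut-leaf = 0 , 0∉ (proj₁ (stem-names 0)) , deep (hereτ (cut zero (s≤s z≤n ∷ z≤n ∷ [])))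

    fire-e : Step net (root (1 ∷ 1 ∷ [])) 1 e (root (0 ∷ 0 ∷ []))
    fire-e = 0 , 0∉ (s≤s z≤n ∷ []) , el zero (s≤s z≤n ∷ s≤s z≤n ∷ [])

later-stem-disables-probe : ∀ {i j} → i < j → ¬ Enabled (stem-state j) (probe i)
later-stem-disables-probe {i} i<j with m≤n⇒∃[o]m+o≡n i<j
... | d , refl = stem-disables (suc i) (stem (chain-is-Chain 2 (suc i + d)))

proposition1 : Σ RPN λ N → (_≤_ : State N → State N → Set) →
    ¬ (IsWQO N _≤_ × TransitionPreservingCompatible N _≤_)
proposition1 = net , ¬wqo×compatible-of-separating stem-state probe
                       stem-state-enables-probe later-stem-disables-probe
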